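{- Let $a\ge 1$ and $n\ge 1$ be integers and put $M=an+2$. Then, as Laurent polynomials in $x,y,p,q$, \[ F_{(1,a)}(x,y,p,q;n)=F_{(a,1)}\bigl(p^{M}q^{M}x,\;y,\;q^{ -1},\;p^{ -1};\;n\bigr), \] where $F_{(1,a)}$ and $F_{(a,1)}$ are the generating functions defined in the context.
   Context: Lattice paths use up steps $U=(0,1)$ and right steps $D=(1,0)$ and are written as words in $\{U,D\}$. A path $\nu$ is weakly below a path $\nu_0$ with the same endpoints if, for every $t$, the number of $D$'s among the first $t$ steps of $\nu$ is at least that of $\nu_0$. A $(1,a)$-Dyck path of size $n$ is a lattice path from $(0,0)$ to $(an,n)$ weakly below $(UD^{a})^{n}$. An $(a,1)$-Dyck path of size $n$ is a lattice path from $(0,0)$ to $(n,an)$ weakly below $(U^{a}D)^{n}$. A peak of a path is an occurrence of two consecutive steps $UD$. Its coordinate $(i,j)$ is the lattice point where the $U$ ends and the $D$ begins. For a $(1,a)$-Dyck path of size $n$, a peak at $(i,j)$ gets the segment $[l,r]$ with $l=an-i$ and $r=a(n+1-j)+1$. For an $(a,1)$-Dyck path of size $n$, a peak at $(i,j)$ gets the segment $[l,r]$ with $l=a(n-1-i)+1$ and $r=an+2-j$. In the paper these segments are the staircases of the associated "heap of type I". A heap is weighted by $x^{\#\text{staircases}}\,y^{\sum\text{lengths of pieces}}\,p^{\sum\text{left abscissae of staircases}}\,q^{\sum\text{right abscissae of staircases}}$, and a staircase $[l,r]$ has total piece length $r-l$. Explicitly, \[ F_{(1,a)}(x,y,p,q;n)=\sum_{\mu}\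 \prod_{\text{peaks of }\mu} x\,y^{\,r-l}\,p^{\,l}\,q^{\,r}, \] where the sum runs over $(1,a)$-Dyck paths of size $n$ and the empty product is $1$. $F_{(a,1)}(x,y,p,q;n)$ is defined in the same way, summing over $(a,1)$-Dyck paths of size $n$ with the $(a,1)$ labels. -}

module Defs where

open import Data.Nat as ℕ using (ℕ; zero; suc; _≤ᵇ_; _≡ᵇ_)
open import Data.Integer as ℤ using (ℤ; +_; _-_)
open import Data.Integer.Properties as ℤP using ()
open import Data.Bool using (Bool; true; false; _∧_)
open import Data.List using (List; []; _∷_; _++_; map; length; take; replicate; concat; foldr)
open import Data.List.Base using (upTo)
open import Data.Product using (_×_; _,_)
open import Relation.Binary.PropositionalEquality using (_≡_)
open import Relation.Nullary using (Dec; yes; no)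
open import Relation.Nullary.Decidable using (⌊_⌋)
open import Data.Product.Properties using (≡-dec)

-- Lattice paths: U = (0,1), D = (1,0)

data Step : Set where
  U D : Step

Path : Set
Path = List Step

allWords : ℕ → List Path
allWords zero    = [] ∷ []
allWords (suc k) = map (U ∷_) (allWords k) ++ map (D ∷_) (allWords k)

countD : Path → ℕ
countD []      = 0
countD (U ∷ w) = countD w
countD (D ∷ w) = suc (countD w)

weaklyBelowᵇ : Path → Path → Bool
weaklyBelowᵇ ν ν₀ = go (upTo (suc (length ν)))
  where
  go : List ℕ → Bool
  go []      = true
  go (t ∷ ts) = (countD (take t ν₀) ≤ᵇ countD (take t ν)) ∧ go ts

filterᵇ : {A : Set} → (A → Bool) → List A → List A
filterᵇ P []       = []
filterᵇ P (x ∷ xs) with P x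
... | true  = x ∷ filterᵇ P xs
... | false = filterᵇ P xs

rep : ℕ → Path → Path
rep k w = concat (replicate k w)

bound1a : ℕ → ℕ → Path
bound1a a n = rep n (U ∷ replicate a D)

bounda1 : ℕ → ℕ → Path
bounda1 a n = rep n (replicate a U ++ D ∷ [])

-- (1,a)-Dyck paths of size n: paths (0,0) → (an,n) weakly below (UD^a)^n
-- (words of length (a+1)n with exactly an D's, hence n U's)
dyck1a : ℕ → ℕ → List Path
dyck1a a n = filterᵇ (λ ν → ⌊ ℕ._≟_ (countD ν) (a ℕ.* n) ⌋ ∧ weaklyBelowᵇ ν (bound1a a n)) (allWords (suc a ℕ.* n))

-- (a,1)-Dyck paths of size n: paths (0,0) → (n,an) weakly below (U^aD)^n
-- (words of length (a+1)n with exactly n D's, hence an U's)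
dycka1 : ℕ → ℕ → List Path
dycka1 a n = filterᵇ (λ ν → ⌊ ℕ._≟_ (countD ν) n ⌋ ∧ weaklyBelowᵇ ν (bounda1 a n)) (allWords (suc a ℕ.* n))

-- peaks: occurrences of U D, with coordinate (i,j) = point where U ends
-- i = number of D's before, j = number of U's up to and including this U
peaksFrom : ℕ → ℕ → Path → List (ℕ × ℕ)
peaksFrom i j []           = []
peaksFrom i j (D ∷ w)      = peaksFrom (suc i) j w
peaksFrom i j (U ∷ [])     = []
peaksFrom i j (U ∷ U ∷ w)  = peaksFrom i (suc j) (U ∷ w)
peaksFrom i j (U ∷ D ∷ w)  = (i , suc j) ∷ peaksFrom (suc i) (suc j) w

peaks : Path → List (ℕ × ℕ)
peaks = peaksFrom 0 0

-- Laurent monomials in x, y, p, q : exponent vectors in ℤ⁴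
-- (ex , ey , ep , eq)  stands for  x^ex y^ey p^ep q^eq

Monomial : Set
Monomial = ℤ × ℤ × ℤ × ℤ

one : Monomial
one = (+ 0 , + 0 , + 0 , + 0)

_·_ : Monomial → Monomial → Monomial
(a₁ , b₁ , c₁ , d₁) · (a₂ , b₂ , c₂ , d₂) = (a₁ ℤ.+ a₂ , b₁ ℤ.+ b₂ , c₁ ℤ.+ c₂ , d₁ ℤ.+ d₂)

_^ᵐ_ : Monomial → ℤ → Monomial
(a , b , c , d) ^ᵐ e = (e ℤ.* a , e ℤ.* b , e ℤ.* c , e ℤ.* d)

varX varY varP varQ : Monomial
varX = (+ 1 , + 0 , + 0 , + 0)
varY = (+ 0 , + 1 , + 0 , + 0)
varP = (+ 0 , + 0 , + 1 , + 0)
varQ = (+ 0 , + 0 , + 0 , + 1)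

_≟ᵐ_ : (m m' : Monomial) → Dec (m ≡ m')
_≟ᵐ_ = ≡-dec ℤ._≟_ (≡-dec ℤ._≟_ (≡-dec ℤ._≟_ ℤ._≟_))

-- Laurent polynomial with ℕ coefficients, as a formal sum of monomials
LPoly : Set
LPoly = List Monomial

coeff : Monomial → LPoly → ℕ
coeff m []        = 0
coeff m (m' ∷ ms) with m' ≟ᵐ m
... | yes _ = suc (coeff m ms)
... | no  _ = coeff m ms

_≈ᴸ_ : LPoly → LPoly → Set
P ≈ᴸ Q = ∀ m → coeff m P ≡ coeff m Q

substMono : Monomial → Monomial → Monomial → Monomial → Monomial → Monomial
substMono mx my mp mq (ex , ey , ep , eq) = (((mx ^ᵐ ex) · (my ^ᵐ ey)) · (mp ^ᵐ ep)) · (mq ^ᵐ eq)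

substPoly : Monomial → Monomial → Monomial → Monomial → LPoly → LPoly
substPoly mx my mp mq = map (substMono mx my mp mq)

peakWeight : ℤ → ℤ → Monomial
peakWeight l r = ((varX · (varY ^ᵐ (r - l))) · (varP ^ᵐ l)) · (varQ ^ᵐ r)

prodM : List Monomial → Monomial
prodM = foldr _·_ one

seg1a : ℕ → ℕ → ℕ × ℕ → Monomial
seg1a a n (i , j) =
  peakWeight (+ (a ℕ.* n) - + i) (+ a ℤ.* (+ (suc n) - + j) ℤ.+ + 1)

sega1 : ℕ → ℕ → ℕ × ℕ → Monomial
sega1 a n (i , j) =
  peakWeight (+ a ℤ.* ((+ n - + 1) - + i) ℤ.+ + 1) (+ (a ℕ.* n ℕ.+ 2) - + j)

F1a : ℕ → ℕ → LPoly
F1a a n = map (λ μ → prodM (map (seg1a a n) (peaks μ))) (dyck1a a n)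

Fa1 : ℕ → ℕ → LPoly
Fa1 a n = map (λ μ → prodM (map (sega1 a n) (peaks μ))) (dycka1 a n)

-- Reversing a word and exchanging U and D (reflection in the antidiagonal) is an
-- involution on words of length (a+1)n.  A prefix of the image is the image of the
-- complementary suffix, so the involution respects "weakly below" and maps the (1,a)-Dyck
-- paths of size n onto the (a,1)-Dyck paths of size n, (UD^a)^n onto (U^aD)^n.  A peak UD
-- stays a peak: the peak at (I , J) goes to the peak at (n - J , an - I), whose
-- (a,1)-segment is [a(J-1)+1 , I+2].  The substitution sends x y^(r-l) p^l q^r to
-- x y^(r-l) p^(M-r) q^(M-l), turning this segment into [an-I , a(n+1-J)+1], the
-- (1,a)-segment of the original peak.  So both sides have the same terms; coefficients are
-- compared by counting words of length (a+1)n, a count invariant under the involution.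
module Submission where

open import Defs
open import Algebra.Structures using (IsCommutativeMonoid)
open import Data.Product using (_×_; _,_)
open import Data.List
  using (List; []; _∷_; _++_; _∷ʳ_; [_]; map; length; take; drop; reverse; replicate; upTo; applyUpTo)
open import Data.List.Properties as List using (++-assoc; ++-identityʳ; take++drop≡id; unfold-reverse)
open import Relation.Binary.PropositionalEquality
  using (_≡_; _≗_; refl; sym; trans; cong; cong₂; subst; subst₂; setoid; isEquivalence; module ≡-Reasoning)

module LaurentMonomial where

  open import Data.Nat as Nat using ()
  open import Data.Integer using (ℤ; +_; -_; _+_; _*_; _-_)
  import Data.Integer.Properties as ℤ
  open import Data.Integer.Tactic.RingSolver using (solve-∀)
  open import Data.List.Relation.Binary.Permutation.Setoid.Properties (setoid Monomial)
    using (foldr-commMonoid; ↭-reverse)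

  monomial-≡ : {a b c d a′ b′ c′ d′ : ℤ} → a ≡ a′ → b ≡ b′ → c ≡ c′ → d ≡ d′ →
    (a , b , c , d) ≡ (a′ , b′ , c′ , d′)
  monomial-≡ refl refl refl refl = refl

  ·-assoc : (u v w : Monomial) → (u · v) · w ≡ u · (v · w)
  ·-assoc (a , b , c , d) (a′ , b′ , c′ , d′) (a″ , b″ , c″ , d″) =
    monomial-≡ (ℤ.+-assoc a a′ a″) (ℤ.+-assoc b b′ b″) (ℤ.+-assoc c c′ c″) (ℤ.+-assoc d d′ d″)

  ·-comm : (u v : Monomial) → u · v ≡ v · u
  ·-comm (a , b , c , d) (a′ , b′ , c′ , d′) =
    monomial-≡ (ℤ.+-comm a a′) (ℤ.+-comm b b′) (ℤ.+-comm c c′) (ℤ.+-comm d d′)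

  ·-identityˡ : (u : Monomial) → one · u ≡ u
  ·-identityˡ (a , b , c , d) =
    monomial-≡ (ℤ.+-identityˡ a) (ℤ.+-identityˡ b) (ℤ.+-identityˡ c) (ℤ.+-identityˡ d)

  ·-isCommutativeMonoid : IsCommutativeMonoid _≡_ _·_ one
  ·-isCommutativeMonoid = record
    { isMonoid = record
      { isSemigroup = record
        { isMagma = record { isEquivalence = isEquivalence ; ∙-cong = cong₂ _·_ }
        ; assoc   = ·-assoc
        }
      ; identity = ·-identityˡ , λ u → trans (·-comm u one) (·-identityˡ u)
      }
    ; comm = ·-comm
    }

  prodM-reverse : (us : List Monomial) → prodM (reverse us) ≡ prodM us
  prodM-reverse us = foldr-commMonoid ·-isCommutativeMonoid (↭-reverse us)

  linearCombination-+ : ∀ a b c d a′ b′ c′ d′ x y p q →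
    (((a + a′) * x + (b + b′) * y) + (c + c′) * p) + (d + d′) * q
    ≡ (((a * x + b * y) + c * p) + d * q) + (((a′ * x + b′ * y) + c′ * p) + d′ * q)
  linearCombination-+ = solve-∀

  substMono-· : (mx my mp mq u v : Monomial) →
    substMono mx my mp mq (u · v) ≡ substMono mx my mp mq u · substMono mx my mp mq v
  substMono-· (x₁ , x₂ , x₃ , x₄) (y₁ , y₂ , y₃ , y₄) (p₁ , p₂ , p₃ , p₄) (q₁ , q₂ , q₃ , q₄)
              (a , b , c , d) (a′ , b′ , c′ , d′) =
    monomial-≡ (linearCombination-+ a b c d a′ b′ c′ d′ x₁ y₁ p₁ q₁)
               (linearCombination-+ a b c d a′ b′ c′ d′ x₂ y₂ p₂ q₂)
               (linearCombination-+ a b c d a′ b′ c′ d′ x₃ y₃ p₃ q₃)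
               (linearCombination-+ a b c d a′ b′ c′ d′ x₄ y₄ p₄ q₄)

  substMono-prodM : (mx my mp mq : Monomial) (us : List Monomial) →
    substMono mx my mp mq (prodM us) ≡ prodM (map (substMono mx my mp mq) us)
  substMono-prodM mx my mp mq []       = refl
  substMono-prodM mx my mp mq (u ∷ us) = trans (substMono-· mx my mp mq u (prodM us))
    (cong (substMono mx my mp mq u ·_) (substMono-prodM mx my mp mq us))

  substitute : ℤ → Monomial → Monomial
  substitute M = substMono (((varP ^ᵐ M) · (varQ ^ᵐ M)) · varX) varY (varQ ^ᵐ (- (+ 1))) (varP ^ᵐ (- (+ 1)))

  -- The left-hand sides below are the coordinates with _·_ and _^ᵐ_ unfolded; the ring
  -- solver does not unfold definitions, so they have to be spelled out.

  peakWeight-coordinates : (l r : ℤ) → peakWeight l r ≡ (+ 1 , r - l , l , r)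
  peakWeight-coordinates l r =
    monomial-≡ (x-exponent (r - l) l r) (y-exponent (r - l) l r) (p-exponent (r - l) l r) (q-exponent (r - l) l r)
    where
    x-exponent : ∀ e l r → ((+ 1 + e * + 0) + l * + 0) + r * + 0 ≡ + 1
    x-exponent = solve-∀
    y-exponent : ∀ e l r → ((+ 0 + e * + 1) + l * + 0) + r * + 0 ≡ e
    y-exponent = solve-∀
    p-exponent : ∀ e l r → ((+ 0 + e * + 0) + l * + 1) + r * + 0 ≡ l
    p-exponent = solve-∀
    q-exponent : ∀ e l r → ((+ 0 + e * + 0) + l * + 0) + r * + 1 ≡ r
    q-exponent = solve-∀

  substitute-coordinates : (M f g h : ℤ) → substitute M (+ 1 , f , g , h) ≡ (+ 1 , f , M - h , M - g)
  substitute-coordinates M f g h =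
    monomial-≡ (x-exponent M f g h) (y-exponent M f g h) (p-exponent M f g h) (q-exponent M f g h)
    where
    x-exponent : ∀ M f g h → ((+ 1 * ((M * + 0 + M * + 0) + + 1) + f * + 0) + g * + 0) + h * + 0 ≡ + 1
    x-exponent = solve-∀
    y-exponent : ∀ M f g h → ((+ 1 * ((M * + 0 + M * + 0) + + 0) + f * + 1) + g * + 0) + h * + 0 ≡ f
    y-exponent = solve-∀
    p-exponent : ∀ M f g h → ((+ 1 * ((M * + 1 + M * + 0) + + 0) + f * + 0) + g * + 0) + h * - + 1 ≡ M - h
    p-exponent = solve-∀
    q-exponent : ∀ M f g h → ((+ 1 * ((M * + 0 + M * + 1) + + 0) + f * + 0) + g * - + 1) + h * + 0 ≡ M - g
    q-exponent = solve-∀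

  substitute-peakWeight : (M l r : ℤ) → substitute M (peakWeight l r) ≡ peakWeight (M - r) (M - l)
  substitute-peakWeight M l r = begin
    substitute M (peakWeight l r)              ≡⟨ cong (substitute M) (peakWeight-coordinates l r) ⟩
    substitute M (+ 1 , r - l , l , r)         ≡⟨ substitute-coordinates M (r - l) l r ⟩
    (+ 1 , r - l , M - r , M - l)              ≡⟨ cong (λ e → (+ 1 , e , M - r , M - l)) (difference M l r) ⟩
    (+ 1 , (M - l) - (M - r) , M - r , M - l)  ≡⟨ peakWeight-coordinates (M - r) (M - l) ⟨
    peakWeight (M - r) (M - l)                 ∎
    where
    open ≡-Reasoning
    difference : ∀ M l r → r - l ≡ (M - l) - (M - r)
    difference = solve-∀

  substitute-dualSegment : (A N AN I J i j : ℤ) → AN ≡ A * N → i ≡ N - J → j ≡ AN - I →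
    substitute (AN + + 2) (peakWeight (A * ((N - + 1) - i) + + 1) ((AN + + 2) - j))
    ≡ peakWeight (AN - I) (A * ((+ 1 + N) - J) + + 1)
  substitute-dualSegment A N _ I J _ _ refl refl refl =
    trans (substitute-peakWeight (A * N + + 2) (A * ((N - + 1) - (N - J)) + + 1) ((A * N + + 2) - (A * N - I)))
          (cong₂ peakWeight (left A N I) (right A N J))
    where
    left : ∀ A N I → (A * N + + 2) - ((A * N + + 2) - (A * N - I)) ≡ A * N - I
    left = solve-∀
    right : ∀ A N J → (A * N + + 2) - (A * ((N - + 1) - (N - J)) + + 1) ≡ A * ((+ 1 + N) - J) + + 1
    right = solve-∀

  pos-complement : {m k n : Nat.ℕ} → m Nat.+ k ≡ n → + m ≡ + n - + k
  pos-complement {m} {k} refl = cancel (+ m) (+ k)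
    where
    cancel : ∀ x y → x ≡ (x + y) - y
    cancel = solve-∀

open LaurentMonomial

open import Data.Nat using (ℕ; zero; suc; _+_; _*_; _∸_; _⊓_; _≤_; _≥_; _≤ᵇ_; _≟_; s≤s; s≤s⁻¹)
open import Data.Nat.Properties as ℕ using (+-suc; +-comm; +-assoc; ≤ᵇ⇒≤; ≤⇒≤ᵇ)
open import Algebra.Properties.CommutativeSemigroup ℕ.+-commutativeSemigroup using (interchange)
open import Data.Bool using (Bool; true; false; T; _∧_; if_then_else_)
open import Data.Bool.ListAction using (all)
open import Data.List.Relation.Unary.All.Properties using (all⁺; all⁻; applyUpTo⁺₁; applyUpTo⁻)
open import Data.List.Relation.Binary.Pointwise as Pointwise using (Pointwise; []; _∷_; Pointwise-≡⇒≡)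
open import Function using (_∘_; id; _⇔_; mk⇔; Equivalence)
open Equivalence using (to; from)
open import Relation.Nullary using (yes; no; contradiction)
open import Relation.Nullary.Decidable using (⌊_⌋; does-⇔; T?)

countᵇ : {A : Set} → (A → Bool) → List A → ℕ
countᵇ p []       = 0
countᵇ p (x ∷ xs) = if p x then suc (countᵇ p xs) else countᵇ p xs

countᵇ-++ : {A : Set} (p : A → Bool) (xs ys : List A) → countᵇ p (xs ++ ys) ≡ countᵇ p xs + countᵇ p ys
countᵇ-++ p []       ys = refl
countᵇ-++ p (x ∷ xs) ys with p x
... | true  = cong suc (countᵇ-++ p xs ys)
... | false = countᵇ-++ p xs ys

countᵇ-map : {A B : Set} (p : B → Bool) (f : A → B) (xs : List A) → countᵇ p (map f xs) ≡ countᵇ (p ∘ f) xs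
countᵇ-map p f []       = refl
countᵇ-map p f (x ∷ xs) rewrite countᵇ-map p f xs = refl

countU : Path → ℕ
countU []      = 0
countU (U ∷ w) = suc (countU w)
countU (D ∷ w) = countU w

countU+countD≡length : (w : Path) → countU w + countD w ≡ length w
countU+countD≡length []      = refl
countU+countD≡length (U ∷ w) = cong suc (countU+countD≡length w)
countU+countD≡length (D ∷ w) = trans (+-suc (countU w) (countD w)) (cong suc (countU+countD≡length w))

countU≡⇔countD≡ : (w : Path) {n m : ℕ} → length w ≡ n + m → countU w ≡ n ⇔ countD w ≡ m
countU≡⇔countD≡ w {n} {m} ∣w∣≡n+m = mk⇔
  (λ Uw≡n → ℕ.+-cancelˡ-≡ n _ _ (trans (cong (_+ countD w) (sym Uw≡n)) U+D≡n+m))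
  (λ Dw≡m → ℕ.+-cancelʳ-≡ m _ _ (trans (cong (countU w +_) (sym Dw≡m)) U+D≡n+m))
  where
  U+D≡n+m : countU w + countD w ≡ n + m
  U+D≡n+m = trans (countU+countD≡length w) ∣w∣≡n+m

countU-cong : (ν ν₀ : Path) → length ν ≡ length ν₀ → countD ν ≡ countD ν₀ → countU ν ≡ countU ν₀
countU-cong ν ν₀ ∣ν∣≡∣ν₀∣ = from (countU≡⇔countD≡ ν (trans ∣ν∣≡∣ν₀∣ (sym (countU+countD≡length ν₀))))

countU-++ : (v w : Path) → countU (v ++ w) ≡ countU v + countU w
countU-++ []      w = refl
countU-++ (U ∷ v) w = cong suc (countU-++ v w)
countU-++ (D ∷ v) w = countU-++ v w

countD-++ : (v w : Path) → countD (v ++ w) ≡ countD v + countD w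
countD-++ []      w = refl
countD-++ (U ∷ v) w = countD-++ v w
countD-++ (D ∷ v) w = cong suc (countD-++ v w)

swapStep : Step → Step
swapStep U = D
swapStep D = U

reverseSwap : Path → Path
reverseSwap []      = []
reverseSwap (s ∷ w) = reverseSwap w ∷ʳ swapStep s

reverseSwap-++ : (v w : Path) → reverseSwap (v ++ w) ≡ reverseSwap w ++ reverseSwap v
reverseSwap-++ []      w = sym (++-identityʳ (reverseSwap w))
reverseSwap-++ (s ∷ v) w =
  trans (cong (_∷ʳ swapStep s) (reverseSwap-++ v w)) (++-assoc (reverseSwap w) (reverseSwap v) [ swapStep s ])

reverseSwap-involutive : (w : Path) → reverseSwap (reverseSwap w) ≡ w
reverseSwap-involutive []      = refl
reverseSwap-involutive (U ∷ w) =
  trans (reverseSwap-++ (reverseSwap w) [ D ]) (cong (U ∷_) (reverseSwap-involutive w))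
reverseSwap-involutive (D ∷ w) =
  trans (reverseSwap-++ (reverseSwap w) [ U ]) (cong (D ∷_) (reverseSwap-involutive w))

length-reverseSwap : (w : Path) → length (reverseSwap w) ≡ length w
length-reverseSwap []      = refl
length-reverseSwap (s ∷ w) =
  trans (List.length-++ (reverseSwap w)) (trans (+-comm _ 1) (cong suc (length-reverseSwap w)))

countD-reverseSwap : (w : Path) → countD (reverseSwap w) ≡ countU w
countD-reverseSwap []      = refl
countD-reverseSwap (U ∷ w) =
  trans (countD-++ (reverseSwap w) [ D ]) (trans (+-comm _ 1) (cong suc (countD-reverseSwap w)))
countD-reverseSwap (D ∷ w) =
  trans (countD-++ (reverseSwap w) [ U ]) (trans (ℕ.+-identityʳ _) (countD-reverseSwap w))

countU-reverseSwap : (w : Path) → countU (reverseSwap w) ≡ countD w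
countU-reverseSwap w = trans (sym (countD-reverseSwap (reverseSwap w))) (cong countD (reverseSwap-involutive w))

countᵇ-allWords-∷ : (k : ℕ) (p : Path → Bool) →
  countᵇ p (allWords (suc k)) ≡ countᵇ (p ∘ (U ∷_)) (allWords k) + countᵇ (p ∘ (D ∷_)) (allWords k)
countᵇ-allWords-∷ k p = trans (countᵇ-++ p (map (U ∷_) (allWords k)) _)
  (cong₂ _+_ (countᵇ-map p _ (allWords k)) (countᵇ-map p _ (allWords k)))

countᵇ-allWords-∷ʳ : (k : ℕ) (p : Path → Bool) →
  countᵇ p (allWords (suc k)) ≡ countᵇ (p ∘ (_∷ʳ U)) (allWords k) + countᵇ (p ∘ (_∷ʳ D)) (allWords k)
countᵇ-allWords-∷ʳ zero p with p [ U ]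
... | true  = refl
... | false = refl
countᵇ-allWords-∷ʳ (suc k) p = begin
  countᵇ p (allWords (suc (suc k)))
    ≡⟨ countᵇ-allWords-∷ (suc k) p ⟩
  countᵇ (p ∘ (U ∷_)) (allWords (suc k)) + countᵇ (p ∘ (D ∷_)) (allWords (suc k))
    ≡⟨ cong₂ _+_ (countᵇ-allWords-∷ʳ k (p ∘ (U ∷_))) (countᵇ-allWords-∷ʳ k (p ∘ (D ∷_))) ⟩
  (count U U + count U D) + (count D U + count D D)
    ≡⟨ interchange (count U U) (count U D) (count D U) (count D D) ⟩
  (count U U + count D U) + (count U D + count D D)
    ≡⟨ cong₂ _+_ (countᵇ-allWords-∷ k (p ∘ (_∷ʳ U))) (countᵇ-allWords-∷ k (p ∘ (_∷ʳ D))) ⟨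
  countᵇ (p ∘ (_∷ʳ U)) (allWords (suc k)) + countᵇ (p ∘ (_∷ʳ D)) (allWords (suc k)) ∎
  where
  open ≡-Reasoning
  count : Step → Step → ℕ
  count first last = countᵇ (λ w → p (first ∷ w ∷ʳ last)) (allWords k)

countᵇ-allWords-cong : (k : ℕ) {p q : Path → Bool} → (∀ w → length w ≡ k → p w ≡ q w) →
  countᵇ p (allWords k) ≡ countᵇ q (allWords k)
countᵇ-allWords-cong zero    p≡q = cong (λ b → if b then 1 else 0) (p≡q [] refl)
countᵇ-allWords-cong (suc k) {p} {q} p≡q = begin
  countᵇ p (allWords (suc k))
    ≡⟨ countᵇ-allWords-∷ k p ⟩
  countᵇ (p ∘ (U ∷_)) (allWords k) + countᵇ (p ∘ (D ∷_)) (allWords k)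
    ≡⟨ cong₂ _+_ (countᵇ-allWords-cong k (λ w ∣w∣≡k → p≡q (U ∷ w) (cong suc ∣w∣≡k)))
                 (countᵇ-allWords-cong k (λ w ∣w∣≡k → p≡q (D ∷ w) (cong suc ∣w∣≡k))) ⟩
  countᵇ (q ∘ (U ∷_)) (allWords k) + countᵇ (q ∘ (D ∷_)) (allWords k)
    ≡⟨ countᵇ-allWords-∷ k q ⟨
  countᵇ q (allWords (suc k)) ∎
  where open ≡-Reasoning

countᵇ-allWords-reverseSwap : (k : ℕ) (p : Path → Bool) →
  countᵇ (p ∘ reverseSwap) (allWords k) ≡ countᵇ p (allWords k)
countᵇ-allWords-reverseSwap zero    p = refl
countᵇ-allWords-reverseSwap (suc k) p = begin
  countᵇ (p ∘ reverseSwap) (allWords (suc k))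
    ≡⟨ countᵇ-allWords-∷ k (p ∘ reverseSwap) ⟩
  countᵇ (p ∘ (_∷ʳ D) ∘ reverseSwap) (allWords k) + countᵇ (p ∘ (_∷ʳ U) ∘ reverseSwap) (allWords k)
    ≡⟨ cong₂ _+_ (countᵇ-allWords-reverseSwap k (p ∘ (_∷ʳ D))) (countᵇ-allWords-reverseSwap k (p ∘ (_∷ʳ U))) ⟩
  countᵇ (p ∘ (_∷ʳ D)) (allWords k) + countᵇ (p ∘ (_∷ʳ U)) (allWords k)
    ≡⟨ +-comm (countᵇ (p ∘ (_∷ʳ D)) (allWords k)) _ ⟩
  countᵇ (p ∘ (_∷ʳ U)) (allWords k) + countᵇ (p ∘ (_∷ʳ D)) (allWords k)
    ≡⟨ countᵇ-allWords-∷ʳ k p ⟨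
  countᵇ p (allWords (suc k)) ∎
  where open ≡-Reasoning

WeaklyBelow : Path → Path → Set
WeaklyBelow ν ν₀ = ∀ {t} → t ≤ length ν → countD (take t ν₀) ≤ countD (take t ν)

all-universal : {A : Set} (p : A → Bool) (g : List A → Bool) →
  g [] ≡ true → (∀ x xs → g (x ∷ xs) ≡ p x ∧ g xs) → g ≗ all p
all-universal p g g[] g∷ []       = g[]
all-universal p g g[] g∷ (x ∷ xs) = trans (g∷ x xs) (cong (p x ∧_) (all-universal p g g[] g∷ xs))

belowAtᵇ : Path → Path → ℕ → Bool
belowAtᵇ ν ν₀ t = countD (take t ν₀) ≤ᵇ countD (take t ν)

-- The loop inside weaklyBelowᵇ has no name; abstracting the tail of upTo lets unification
-- supply it as the function g of all-universal.
weaklyBelowᵇ≡all : (ν ν₀ : Path) → weaklyBelowᵇ ν ν₀ ≡ all (belowAtᵇ ν ν₀) (upTo (suc (length ν)))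
weaklyBelowᵇ≡all ν ν₀ with applyUpTo suc (length ν) | all-universal (belowAtᵇ ν ν₀) _
... | ts | go≗all = cong (_ ∧_) (go≗all refl (λ _ _ → refl) ts)

weaklyBelowᵇ-correct : (ν ν₀ : Path) → T (weaklyBelowᵇ ν ν₀) ⇔ WeaklyBelow ν ν₀
weaklyBelowᵇ-correct ν ν₀ = mk⇔
  (λ wb {t} t≤ν → ≤ᵇ⇒≤ _ _ (applyUpTo⁻ id (suc (length ν))
     (all⁺ (belowAtᵇ ν ν₀) _ (subst T (weaklyBelowᵇ≡all ν ν₀) wb)) (s≤s t≤ν)))
  (λ (wb : WeaklyBelow ν ν₀) → subst T (sym (weaklyBelowᵇ≡all ν ν₀))
     (all⁻ (belowAtᵇ ν ν₀) (applyUpTo⁺₁ id (suc (length ν)) (λ t<1+ν → ≤⇒≤ᵇ (wb (s≤s⁻¹ t<1+ν))))))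

take-length-++ : {A : Set} (xs ys : List A) → take (length xs) (xs ++ ys) ≡ xs
take-length-++ []       ys = refl
take-length-++ (x ∷ xs) ys = cong (x ∷_) (take-length-++ xs ys)

take-reverseSwap : (s t : ℕ) (ν : Path) → s + t ≡ length ν → take t (reverseSwap ν) ≡ reverseSwap (drop s ν)
take-reverseSwap s t ν s+t≡ν = begin
  take t (reverseSwap ν)
    ≡⟨ cong (take t ∘ reverseSwap) (take++drop≡id s ν) ⟨
  take t (reverseSwap (take s ν ++ drop s ν))
    ≡⟨ cong (take t) (reverseSwap-++ (take s ν) (drop s ν)) ⟩
  take t (reverseSwap (drop s ν) ++ reverseSwap (take s ν))
    ≡⟨ cong (λ k → take k (reverseSwap (drop s ν) ++ _)) t≡∣drop∣ ⟩
  take (length (reverseSwap (drop s ν))) (reverseSwap (drop s ν) ++ reverseSwap (take s ν))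
    ≡⟨ take-length-++ (reverseSwap (drop s ν)) _ ⟩
  reverseSwap (drop s ν) ∎
  where
  open ≡-Reasoning
  t≡∣drop∣ : t ≡ length (reverseSwap (drop s ν))
  t≡∣drop∣ = sym (begin
    length (reverseSwap (drop s ν)) ≡⟨ length-reverseSwap (drop s ν) ⟩
    length (drop s ν)               ≡⟨ List.length-drop s ν ⟩
    length ν ∸ s                    ≡⟨ cong (_∸ s) s+t≡ν ⟨
    s + t ∸ s                       ≡⟨ ℕ.m+n∸m≡n s t ⟩
    t ∎)

countD-take-reverseSwap : (s t : ℕ) (ν : Path) → s + t ≡ length ν →
  countD (take t (reverseSwap ν)) + s ≡ countU ν + countD (take s ν)
countD-take-reverseSwap s t ν s+t≡ν = begin
  countD (take t (reverseSwap ν)) + s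
    ≡⟨ cong (λ v → countD v + s) (take-reverseSwap s t ν s+t≡ν) ⟩
  countD (reverseSwap (drop s ν)) + s
    ≡⟨ cong₂ _+_ (countD-reverseSwap (drop s ν)) s≡U+D ⟩
  countU (drop s ν) + (countU (take s ν) + countD (take s ν))
    ≡⟨ +-assoc (countU (drop s ν)) _ _ ⟨
  countU (drop s ν) + countU (take s ν) + countD (take s ν)
    ≡⟨ cong (_+ countD (take s ν)) (+-comm (countU (drop s ν)) _) ⟩
  countU (take s ν) + countU (drop s ν) + countD (take s ν)
    ≡⟨ cong (_+ countD (take s ν)) (countU-++ (take s ν) (drop s ν)) ⟨
  countU (take s ν ++ drop s ν) + countD (take s ν)
    ≡⟨ cong (λ v → countU v + countD (take s ν)) (take++drop≡id s ν) ⟩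
  countU ν + countD (take s ν) ∎
  where
  open ≡-Reasoning
  s≡U+D : s ≡ countU (take s ν) + countD (take s ν)
  s≡U+D = sym (begin
    countU (take s ν) + countD (take s ν) ≡⟨ countU+countD≡length (take s ν) ⟩
    length (take s ν)                     ≡⟨ List.length-take s ν ⟩
    s ⊓ length ν                          ≡⟨ ℕ.m≤n⇒m⊓n≡m (subst (s ≤_) s+t≡ν (ℕ.m≤m+n s t)) ⟩
    s ∎)

weaklyBelow-reverseSwap : (ν ν₀ : Path) → length ν ≡ length ν₀ → countD ν ≡ countD ν₀ →
  WeaklyBelow ν ν₀ → WeaklyBelow (reverseSwap ν) (reverseSwap ν₀)
weaklyBelow-reverseSwap ν ν₀ ∣ν∣≡∣ν₀∣ Dν≡Dν₀ ν≤ν₀ {t} t≤∣ν∣ = ℕ.+-cancelʳ-≤ s _ _ (begin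
  countD (take t (reverseSwap ν₀)) + s ≡⟨ countD-take-reverseSwap s t ν₀ (trans s+t≡ν ∣ν∣≡∣ν₀∣) ⟩
  countU ν₀ + countD (take s ν₀)       ≡⟨ cong (_+ countD (take s ν₀)) (countU-cong ν ν₀ ∣ν∣≡∣ν₀∣ Dν≡Dν₀) ⟨
  countU ν + countD (take s ν₀)        ≤⟨ ℕ.+-monoʳ-≤ (countU ν) (ν≤ν₀ (ℕ.m∸n≤m (length ν) t)) ⟩
  countU ν + countD (take s ν)         ≡⟨ countD-take-reverseSwap s t ν s+t≡ν ⟨
  countD (take t (reverseSwap ν)) + s  ∎)
  where
  open ℕ.≤-Reasoning
  s : ℕ
  s = length ν ∸ t
  s+t≡ν : s + t ≡ length ν
  s+t≡ν = ℕ.m∸n+n≡m (subst (t ≤_) (length-reverseSwap ν) t≤∣ν∣)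

weaklyBelowᵇ-reverseSwap : (ν ν₀ : Path) → length ν ≡ length ν₀ → countD ν ≡ countD ν₀ →
  weaklyBelowᵇ ν ν₀ ≡ weaklyBelowᵇ (reverseSwap ν) (reverseSwap ν₀)
weaklyBelowᵇ-reverseSwap ν ν₀ ∣ν∣≡∣ν₀∣ Dν≡Dν₀ = does-⇔ (mk⇔ forth back) (T? _) (T? _)
  where
  ∣rν∣≡∣rν₀∣ : length (reverseSwap ν) ≡ length (reverseSwap ν₀)
  ∣rν∣≡∣rν₀∣ = trans (length-reverseSwap ν) (trans ∣ν∣≡∣ν₀∣ (sym (length-reverseSwap ν₀)))
  Drν≡Drν₀ : countD (reverseSwap ν) ≡ countD (reverseSwap ν₀)
  Drν≡Drν₀ = trans (countD-reverseSwap ν) (trans (countU-cong ν ν₀ ∣ν∣≡∣ν₀∣ Dν≡Dν₀) (sym (countD-reverseSwap ν₀)))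
  forth : T (weaklyBelowᵇ ν ν₀) → T (weaklyBelowᵇ (reverseSwap ν) (reverseSwap ν₀))
  forth = from (weaklyBelowᵇ-correct _ _)
        ∘ weaklyBelow-reverseSwap ν ν₀ ∣ν∣≡∣ν₀∣ Dν≡Dν₀
        ∘ to (weaklyBelowᵇ-correct ν ν₀)
  back : T (weaklyBelowᵇ (reverseSwap ν) (reverseSwap ν₀)) → T (weaklyBelowᵇ ν ν₀)
  back = from (weaklyBelowᵇ-correct ν ν₀)
       ∘ subst₂ WeaklyBelow (reverseSwap-involutive ν) (reverseSwap-involutive ν₀)
       ∘ weaklyBelow-reverseSwap (reverseSwap ν) (reverseSwap ν₀) ∣rν∣≡∣rν₀∣ Drν≡Drν₀
       ∘ to (weaklyBelowᵇ-correct _ _)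

peaksFrom-∷ʳU : (i j : ℕ) (w : Path) → peaksFrom i j (w ∷ʳ U) ≡ peaksFrom i j w
peaksFrom-∷ʳU i j []          = refl
peaksFrom-∷ʳU i j (D ∷ w)     = peaksFrom-∷ʳU (suc i) j w
peaksFrom-∷ʳU i j (U ∷ [])    = refl
peaksFrom-∷ʳU i j (U ∷ U ∷ w) = peaksFrom-∷ʳU i (suc j) (U ∷ w)
peaksFrom-∷ʳU i j (U ∷ D ∷ w) = cong ((i , suc j) ∷_) (peaksFrom-∷ʳU (suc i) (suc j) w)

peaksFrom-∷ʳD∷ʳD : (i j : ℕ) (w : Path) → peaksFrom i j (w ∷ʳ D ∷ʳ D) ≡ peaksFrom i j (w ∷ʳ D)
peaksFrom-∷ʳD∷ʳD i j []          = refl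
peaksFrom-∷ʳD∷ʳD i j (D ∷ w)     = peaksFrom-∷ʳD∷ʳD (suc i) j w
peaksFrom-∷ʳD∷ʳD i j (U ∷ [])    = refl
peaksFrom-∷ʳD∷ʳD i j (U ∷ U ∷ w) = peaksFrom-∷ʳD∷ʳD i (suc j) (U ∷ w)
peaksFrom-∷ʳD∷ʳD i j (U ∷ D ∷ w) = cong ((i , suc j) ∷_) (peaksFrom-∷ʳD∷ʳD (suc i) (suc j) w)

peaksFrom-∷ʳU∷ʳD : (i j : ℕ) (w : Path) →
  peaksFrom i j (w ∷ʳ U ∷ʳ D) ≡ peaksFrom i j w ∷ʳ (i + countD w , suc (j + countU w))
peaksFrom-∷ʳU∷ʳD i j []          = sym (cong₂ (λ k l → [ (k , suc l) ]) (ℕ.+-identityʳ i) (ℕ.+-identityʳ j))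
peaksFrom-∷ʳU∷ʳD i j (D ∷ w)     = trans (peaksFrom-∷ʳU∷ʳD (suc i) j w)
  (cong (λ k → peaksFrom (suc i) j w ∷ʳ (k , suc (j + countU w))) (sym (+-suc i (countD w))))
peaksFrom-∷ʳU∷ʳD i j (U ∷ [])    = sym (cong₂ (λ k l → [ (k , suc l) ]) (ℕ.+-identityʳ i) (+-comm j 1))
peaksFrom-∷ʳU∷ʳD i j (U ∷ U ∷ w) = trans (peaksFrom-∷ʳU∷ʳD i (suc j) (U ∷ w))
  (cong (λ k → peaksFrom i (suc j) (U ∷ w) ∷ʳ (i + countD w , suc k)) (sym (+-suc j (countU (U ∷ w)))))
peaksFrom-∷ʳU∷ʳD i j (U ∷ D ∷ w) = cong ((i , suc j) ∷_) (trans (peaksFrom-∷ʳU∷ʳD (suc i) (suc j) w)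
  (cong₂ (λ k l → peaksFrom (suc i) (suc j) w ∷ʳ (k , suc l)) (sym (+-suc i (countD w))) (sym (+-suc j (countU w)))))

Complementary : ℕ → ℕ → ℕ × ℕ → ℕ × ℕ → Set
Complementary c d (i , j) (I , J) = i + J ≡ c × j + I ≡ d

peaks-reverseSwap : (w : Path) (I J : ℕ) →
  Pointwise (Complementary (countU w + J) (countD w + I)) (peaks (reverseSwap w)) (reverse (peaksFrom I J w))
peaks-reverseSwap []          I J = []
peaks-reverseSwap (D ∷ w)     I J =
  subst₂ (λ d ps → Pointwise (Complementary (countU w + J) d) ps (reverse (peaksFrom (suc I) J w)))
    (+-suc (countD w) I) (sym (peaksFrom-∷ʳU 0 0 (reverseSwap w)))
    (peaks-reverseSwap w (suc I) J)
peaks-reverseSwap (U ∷ [])    I J = []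
peaks-reverseSwap (U ∷ U ∷ w) I J =
  subst₂ (λ c ps → Pointwise (Complementary c (countD w + I)) ps (reverse (peaksFrom I (suc J) (U ∷ w))))
    (+-suc (countU (U ∷ w)) J) (sym (peaksFrom-∷ʳD∷ʳD 0 0 (reverseSwap w)))
    (peaks-reverseSwap (U ∷ w) I (suc J))
peaks-reverseSwap (U ∷ D ∷ w) I J =
  subst₂ (Pointwise (Complementary (suc (countU w + J)) (suc (countD w + I))))
    (sym (peaksFrom-∷ʳU∷ʳD 0 0 (reverseSwap w))) (sym (unfold-reverse (I , suc J) (peaksFrom (suc I) (suc J) w)))
    (Pointwise.++⁺ earlierPeaks (lastPeak ∷ []))
  where
  earlierPeaks : Pointwise (Complementary (suc (countU w + J)) (suc (countD w + I)))
                   (peaks (reverseSwap w)) (reverse (peaksFrom (suc I) (suc J) w))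
  earlierPeaks =
    subst₂ (λ c d → Pointwise (Complementary c d) (peaks (reverseSwap w)) (reverse (peaksFrom (suc I) (suc J) w)))
      (+-suc (countU w) J) (+-suc (countD w) I) (peaks-reverseSwap w (suc I) (suc J))
  lastPeak : Complementary (suc (countU w + J)) (suc (countD w + I))
               (countD (reverseSwap w) , suc (countU (reverseSwap w))) (I , suc J)
  lastPeak = trans (cong (_+ suc J) (countD-reverseSwap w)) (+-suc (countU w) J)
           , cong (λ k → suc (k + I)) (countU-reverseSwap w)

reverseSwap-replicate : (k : ℕ) → reverseSwap (replicate k D) ≡ replicate k U
reverseSwap-replicate zero    = refl
reverseSwap-replicate (suc k) = trans (cong (_∷ʳ U) (reverseSwap-replicate k)) (replicate-∷ʳ k)
  where
  replicate-∷ʳ : (k : ℕ) → replicate k U ∷ʳ U ≡ U ∷ replicate k U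
  replicate-∷ʳ zero    = refl
  replicate-∷ʳ (suc k) = cong (U ∷_) (replicate-∷ʳ k)

rep-++-comm : (n : ℕ) (w : Path) → rep n w ++ w ≡ w ++ rep n w
rep-++-comm zero    w = sym (++-identityʳ w)
rep-++-comm (suc n) w = trans (++-assoc w (rep n w) w) (cong (w ++_) (rep-++-comm n w))

reverseSwap-rep : (n : ℕ) (w : Path) → reverseSwap (rep n w) ≡ rep n (reverseSwap w)
reverseSwap-rep zero    w = refl
reverseSwap-rep (suc n) w = begin
  reverseSwap (w ++ rep n w)               ≡⟨ reverseSwap-++ w (rep n w) ⟩
  reverseSwap (rep n w) ++ reverseSwap w   ≡⟨ cong (_++ reverseSwap w) (reverseSwap-rep n w) ⟩
  rep n (reverseSwap w) ++ reverseSwap w   ≡⟨ rep-++-comm n (reverseSwap w) ⟩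
  reverseSwap w ++ rep n (reverseSwap w)   ∎
  where open ≡-Reasoning

countD-rep : (n : ℕ) (w : Path) → countD (rep n w) ≡ n * countD w
countD-rep zero    w = refl
countD-rep (suc n) w = trans (countD-++ w (rep n w)) (cong (countD w +_) (countD-rep n w))

length-rep : (n : ℕ) (w : Path) → length (rep n w) ≡ n * length w
length-rep zero    w = refl
length-rep (suc n) w = trans (List.length-++ w) (cong (length w +_) (length-rep n w))

reverseSwap-bound1a : (a n : ℕ) → reverseSwap (bound1a a n) ≡ bounda1 a n
reverseSwap-bound1a a n =
  trans (reverseSwap-rep n (U ∷ replicate a D)) (cong (rep n ∘ (_∷ʳ D)) (reverseSwap-replicate a))

countD-bound1a : (a n : ℕ) → countD (bound1a a n) ≡ a * n
countD-bound1a a n =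
  trans (countD-rep n (U ∷ replicate a D)) (trans (cong (n *_) (countD-replicate a)) (ℕ.*-comm n a))
  where
  countD-replicate : (k : ℕ) → countD (replicate k D) ≡ k
  countD-replicate zero    = refl
  countD-replicate (suc k) = cong suc (countD-replicate k)

length-bound1a : (a n : ℕ) → length (bound1a a n) ≡ suc a * n
length-bound1a a n = trans (length-rep n (U ∷ replicate a D))
  (trans (cong (λ k → n * suc k) (List.length-replicate a)) (ℕ.*-comm n (suc a)))

open import Data.Integer using (ℤ; +_; -_)
open import Data.Integer.Properties using (pos-*)

substitute-sega1 : (a n : ℕ) {p q : ℕ × ℕ} → Complementary n (a * n) p q →
  substitute (+ (a * n + 2)) (sega1 a n p) ≡ seg1a a n q
substitute-sega1 a n {i , j} {I , J} (i+J≡n , j+I≡an) =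
  substitute-dualSegment (+ a) (+ n) (+ (a * n)) (+ I) (+ J) (+ i) (+ j)
    (pos-* a n) (pos-complement i+J≡n) (pos-complement j+I≡an)

weight1a weighta1 : ℕ → ℕ → Path → Monomial
weight1a a n μ = prodM (map (seg1a a n) (peaks μ))
weighta1 a n μ = prodM (map (sega1 a n) (peaks μ))

substitute-weighta1 : (a n : ℕ) (w : Path) → countU w ≡ n → countD w ≡ a * n →
  substitute (+ (a * n + 2)) (weighta1 a n (reverseSwap w)) ≡ weight1a a n w
substitute-weighta1 a n w Uw≡n Dw≡an = begin
  substitute M (prodM (map (sega1 a n) (peaks (reverseSwap w))))
    ≡⟨ substMono-prodM _ _ _ _ (map (sega1 a n) (peaks (reverseSwap w))) ⟩
  prodM (map (substitute M) (map (sega1 a n) (peaks (reverseSwap w))))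
    ≡⟨ cong prodM (List.map-∘ (peaks (reverseSwap w))) ⟨
  prodM (map (substitute M ∘ sega1 a n) (peaks (reverseSwap w)))
    ≡⟨ cong prodM (Pointwise-≡⇒≡ (Pointwise.map⁺ _ _ substitutedPeaks)) ⟩
  prodM (map (seg1a a n) (reverse (peaks w)))
    ≡⟨ cong prodM (List.reverse-map (seg1a a n) (peaks w)) ⟩
  prodM (reverse (map (seg1a a n) (peaks w)))
    ≡⟨ prodM-reverse (map (seg1a a n) (peaks w)) ⟩
  prodM (map (seg1a a n) (peaks w)) ∎
  where
  open ≡-Reasoning
  M : ℤ
  M = + (a * n + 2)
  matchingPeaks : Pointwise (Complementary n (a * n)) (peaks (reverseSwap w)) (reverse (peaks w))
  matchingPeaks = subst₂ (λ c d → Pointwise (Complementary c d) (peaks (reverseSwap w)) (reverse (peaks w)))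
    (trans (ℕ.+-identityʳ (countU w)) Uw≡n) (trans (ℕ.+-identityʳ (countD w)) Dw≡an) (peaks-reverseSwap w 0 0)
  substitutedPeaks : Pointwise (λ p q → substitute M (sega1 a n p) ≡ seg1a a n q)
                       (peaks (reverseSwap w)) (reverse (peaks w))
  substitutedPeaks = Pointwise.map (λ {p} {q} → substitute-sega1 a n {p} {q}) matchingPeaks

isDyck1aᵇ isDycka1ᵇ : ℕ → ℕ → Path → Bool
isDyck1aᵇ a n ν = ⌊ countD ν ≟ a * n ⌋ ∧ weaklyBelowᵇ ν (bound1a a n)
isDycka1ᵇ a n ν = ⌊ countD ν ≟ n ⌋ ∧ weaklyBelowᵇ ν (bounda1 a n)

dyckTerm-reverseSwap : (a n : ℕ) (m : Monomial) (w : Path) → length w ≡ suc a * n →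
  isDyck1aᵇ a n w ∧ ⌊ weight1a a n w ≟ᵐ m ⌋
  ≡ isDycka1ᵇ a n (reverseSwap w) ∧ ⌊ substitute (+ (a * n + 2)) (weighta1 a n (reverseSwap w)) ≟ᵐ m ⌋
dyckTerm-reverseSwap a n m w ∣w∣ with countD w ≟ a * n | countD (reverseSwap w) ≟ n
... | no _      | no _      = refl
... | yes Dw≡an | no Drw≢n  =
  contradiction (trans (countD-reverseSwap w) (from (countU≡⇔countD≡ w ∣w∣) Dw≡an)) Drw≢n
... | no Dw≢an  | yes Drw≡n =
  contradiction (to (countU≡⇔countD≡ w ∣w∣) (trans (sym (countD-reverseSwap w)) Drw≡n)) Dw≢an
... | yes Dw≡an | yes Drw≡n =
  cong₂ _∧_ belowBound (cong (λ μ → ⌊ μ ≟ᵐ m ⌋) (sym (substitute-weighta1 a n w Uw≡n Dw≡an)))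
  where
  Uw≡n : countU w ≡ n
  Uw≡n = trans (sym (countD-reverseSwap w)) Drw≡n
  belowBound : weaklyBelowᵇ w (bound1a a n) ≡ weaklyBelowᵇ (reverseSwap w) (bounda1 a n)
  belowBound = trans
    (weaklyBelowᵇ-reverseSwap w (bound1a a n)
      (trans ∣w∣ (sym (length-bound1a a n))) (trans Dw≡an (sym (countD-bound1a a n))))
    (cong (weaklyBelowᵇ (reverseSwap w)) (reverseSwap-bound1a a n))

coeff-map-filterᵇ : {A : Set} (m : Monomial) (f : A → Monomial) (P : A → Bool) (xs : List A) →
  coeff m (map f (filterᵇ P xs)) ≡ countᵇ (λ x → P x ∧ ⌊ f x ≟ᵐ m ⌋) xs
coeff-map-filterᵇ m f P []       = refl
coeff-map-filterᵇ m f P (x ∷ xs) with P x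
... | false = coeff-map-filterᵇ m f P xs
... | true with f x ≟ᵐ m
...   | yes _ = cong suc (coeff-map-filterᵇ m f P xs)
...   | no  _ = coeff-map-filterᵇ m f P xs

proposition3p9 : (a n : ℕ) → a ≥ 1 → n ≥ 1 →
    F1a a n ≈ᴸ substPoly (((varP ^ᵐ (+ (a * n + 2))) · (varQ ^ᵐ (+ (a * n + 2)))) · varX) varY (varQ ^ᵐ (- (+ 1))) (varP ^ᵐ (- (+ 1))) (Fa1 a n)
proposition3p9 a n _ _ m = begin
  coeff m (F1a a n)
    ≡⟨ coeff-map-filterᵇ m (weight1a a n) (isDyck1aᵇ a n) (allWords k) ⟩
  countᵇ term1a (allWords k)
    ≡⟨ countᵇ-allWords-cong k (dyckTerm-reverseSwap a n m) ⟩
  countᵇ (terma1 ∘ reverseSwap) (allWords k)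
    ≡⟨ countᵇ-allWords-reverseSwap k terma1 ⟩
  countᵇ terma1 (allWords k)
    ≡⟨ coeff-map-filterᵇ m (substitute M ∘ weighta1 a n) (isDycka1ᵇ a n) (allWords k) ⟨
  coeff m (map (substitute M ∘ weighta1 a n) (dycka1 a n))
    ≡⟨ cong (coeff m) (List.map-∘ (dycka1 a n)) ⟩
  coeff m (map (substitute M) (Fa1 a n)) ∎
  where
  open ≡-Reasoning
  k : ℕ
  k = suc a * n
  M : ℤ
  M = + (a * n + 2)
  term1a terma1 : Path → Bool
  term1a w = isDyck1aᵇ a n w ∧ ⌊ weight1a a n w ≟ᵐ m ⌋
  terma1 w = isDycka1ᵇ a n w ∧ ⌊ substitute M (weighta1 a n w) ≟ᵐ m ⌋
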